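{- Let $k\ge 2$ be an integer, $G=(V,E)$ an undirected graph with bidirected graph $\vec G=(V,E^+\cup E^-)$. The polytope $$\mathcal P_k=\{z\in\mathbb{R}^{E^+\cup E^- }:\ z(\delta^+_{\vec G}(v))=z(\delta^-_{\vec G}(v))\ \forall v\in V,\ 1\le z(e^+)+z(e^-)\le k-1\ \forall e\in E,\ z\ge0\}$$ is the projection onto the $z$-variables of the polytope $$\{(y,z)\in\mathbb{R}^{E^+\cup E^- }\times\mathbb{R}^{E^+\cup E^- }:\ z(\delta^+_{\vec G}(v))=z(\delta^-_{\vec G}(v))\ \forall v\in V,\ y(e^+)+y(e^-)=1\ \forall e\in E,\ y\le z\le (k-1)y,\ y\ge 0\}.$$
   Context: The bidirected graph $\vec G$ has two oppositely oriented arcs $e^+,e^-$ for each edge $e\in E$. For $v\in V$, $\delta^\pm_{\vec G}(v)$ denotes the arcs of $\vec G$ leaving/entering $v$, and for a vector $z$ and arc set $A$, $z(A)=\sum_{a\in A}z(a)$. Inequalities between vectors are coordinatewise.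
   Formalization: The vectors z and y, and hence both polytopes, are taken over ℚ instead of ℝ. -}

module Defs where

open import Data.Nat using (ℕ; _∸_)
open import Data.Fin using (Fin; _≟_)
open import Data.Bool using (Bool; true; false)
open import Data.Product using (_×_; _,_; proj₁; proj₂; ∃)
open import Data.List using (List; foldr; map)
open import Data.Fin.Base using ()
open import Data.List.Base using ()
open import Data.Integer using (+_)
open import Data.Rational using (ℚ; _+_; _*_; _≤_; 0ℚ; 1ℚ; _/_)
open import Relation.Nullary using (yes; no)
open import Relation.Binary.PropositionalEquality using (_≡_)
import Data.List as L
import Data.Fin as F

record Graph : Set where
  field
    n    : ℕ
    m    : ℕ
    ends : Fin m → Fin n × Fin n
open Graph public

-- Orientation of an arc: (e , true) is e⁺ (from u to v), (e , false) is e⁻ (from v to u).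
Arc : Graph → Set
Arc G = Fin (m G) × Bool

tail : (G : Graph) → Arc G → Fin (n G)
tail G (e , true)  = proj₁ (ends G e)
tail G (e , false) = proj₂ (ends G e)

head : (G : Graph) → Arc G → Fin (n G)
head G (e , true)  = proj₂ (ends G e)
head G (e , false) = proj₁ (ends G e)

sumℚ : List ℚ → ℚ
sumℚ = foldr _+_ 0ℚ

allArcs : (G : Graph) → List (Arc G)
allArcs G = L.concatMap (λ e → (e , true) L.∷ (e , false) L.∷ L.[]) (L.allFin (m G))

outSum : (G : Graph) → (Arc G → ℚ) → Fin (n G) → ℚ
outSum G z v = sumℚ (map (λ a → sel (tail G a ≟ v) (z a)) (allArcs G))
  where
  sel : ∀ {P : Set} → Relation.Nullary.Dec P → ℚ → ℚ
  sel (yes _) q = q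
  sel (no _)  q = 0ℚ

inSum : (G : Graph) → (Arc G → ℚ) → Fin (n G) → ℚ
inSum G z v = sumℚ (map (λ a → sel (head G a ≟ v) (z a)) (allArcs G))
  where
  sel : ∀ {P : Set} → Relation.Nullary.Dec P → ℚ → ℚ
  sel (yes _) q = q
  sel (no _)  q = 0ℚ

km1 : ℕ → ℚ
km1 k = (+ (k ∸ 1)) / 1

InPk : (G : Graph) → ℕ → (Arc G → ℚ) → Set
InPk G k z =
  (∀ v → outSum G z v ≡ inSum G z v) ×
  (∀ e → (1ℚ ≤ z (e , true) + z (e , false)) × (z (e , true) + z (e , false) ≤ km1 k)) ×
  (∀ a → 0ℚ ≤ z a)

InQk : (G : Graph) → ℕ → (Arc G → ℚ) → (Arc G → ℚ) → Set
InQk G k y z =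
  (∀ v → outSum G z v ≡ inSum G z v) ×
  (∀ e → y (e , true) + y (e , false) ≡ 1ℚ) ×
  (∀ a → (y a ≤ z a) × (z a ≤ km1 k * y a)) ×
  (∀ a → 0ℚ ≤ y a)

-- Summing y ≤ z ≤ (k-1)y over the two arcs of an edge e, with y(e⁺) + y(e⁻) = 1,
-- gives 1 ≤ z(e⁺) + z(e⁻) ≤ k-1. Conversely, for z ∈ P_k the normalisation
-- y(e^±) = z(e^±) / (z(e⁺) + z(e⁻)) satisfies all the constraints: dividing by
-- a number in [1, k-1] shrinks z, and by at most the factor k-1.
module Submission where

open import Defs
open import Data.Nat using (ℕ; _≤_)
open import Data.Rational using (ℚ)
open import Data.Product using (∃)
open import Function.Bundles using (_⇔_)

open import Data.Bool using (true; false)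
open import Data.Fin using (Fin)
open import Data.Product using (_,_; _×_; proj₁; proj₂)
open import Data.Rational as ℚ using (0ℚ; 1ℚ; 1/_)
open import Data.Rational.Properties
open import Function.Bundles using (mk⇔)
open import Relation.Binary.PropositionalEquality using (_≡_; sym; trans; cong)

1≤+ : ∀ {y₁ y₂ z₁ z₂} → y₁ ℚ.+ y₂ ≡ 1ℚ → y₁ ℚ.≤ z₁ → y₂ ℚ.≤ z₂ → 1ℚ ℚ.≤ z₁ ℚ.+ z₂
1≤+ {y₁} {y₂} {z₁} {z₂} y₁+y₂≡1 y₁≤z₁ y₂≤z₂ = begin
  1ℚ         ≡⟨ sym y₁+y₂≡1 ⟩
  y₁ ℚ.+ y₂  ≤⟨ +-mono-≤ y₁≤z₁ y₂≤z₂ ⟩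
  z₁ ℚ.+ z₂  ∎
  where open ≤-Reasoning

+≤-scale : ∀ {y₁ y₂ z₁ z₂ c} → y₁ ℚ.+ y₂ ≡ 1ℚ → z₁ ℚ.≤ c ℚ.* y₁ → z₂ ℚ.≤ c ℚ.* y₂ → z₁ ℚ.+ z₂ ℚ.≤ c
+≤-scale {y₁} {y₂} {z₁} {z₂} {c} y₁+y₂≡1 z₁≤cy₁ z₂≤cy₂ = begin
  z₁ ℚ.+ z₂                ≤⟨ +-mono-≤ z₁≤cy₁ z₂≤cy₂ ⟩
  c ℚ.* y₁ ℚ.+ c ℚ.* y₂    ≡⟨ sym (*-distribˡ-+ c y₁ y₂) ⟩
  c ℚ.* (y₁ ℚ.+ y₂)        ≡⟨ cong (c ℚ.*_) y₁+y₂≡1 ⟩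
  c ℚ.* 1ℚ                 ≡⟨ *-identityʳ c ⟩
  c                        ∎
  where open ≤-Reasoning

reciprocal-of-1≤ : ∀ {s} → 1ℚ ℚ.≤ s → ∃ λ r → 0ℚ ℚ.≤ r × s ℚ.* r ≡ 1ℚ
reciprocal-of-1≤ {s} 1≤s =
  1/ s , nonNegative⁻¹ (1/ s) {{pos⇒nonNeg (1/ s) {{1/pos⇒pos s}}}} , *-inverseʳ s
  where instance
    s-pos : ℚ.Positive s
    s-pos = ℚ.positive (<-≤-trans (positive⁻¹ 1ℚ) 1≤s)
    s-nonZero : ℚ.NonZero s
    s-nonZero = pos⇒nonZero s

*-reciprocal-≤ : ∀ {x s r} → 0ℚ ℚ.≤ x → 1ℚ ℚ.≤ s → 0ℚ ℚ.≤ r → s ℚ.* r ≡ 1ℚ → x ℚ.* r ℚ.≤ x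
*-reciprocal-≤ {x} {s} {r} 0≤x 1≤s 0≤r sr≡1 = begin
  x ℚ.* r   ≤⟨ *-monoˡ-≤-nonNeg x {{ℚ.nonNegative 0≤x}} r≤1 ⟩
  x ℚ.* 1ℚ  ≡⟨ *-identityʳ x ⟩
  x         ∎
  where
  open ≤-Reasoning
  r≤1 : r ℚ.≤ 1ℚ
  r≤1 = begin
    r          ≡⟨ sym (*-identityˡ r) ⟩
    1ℚ ℚ.* r   ≤⟨ *-monoʳ-≤-nonNeg r {{ℚ.nonNegative 0≤r}} 1≤s ⟩
    s ℚ.* r    ≡⟨ sr≡1 ⟩
    1ℚ         ∎

≤-scale-*-reciprocal : ∀ {x s c r} → 0ℚ ℚ.≤ x → s ℚ.≤ c → 0ℚ ℚ.≤ r → s ℚ.* r ≡ 1ℚ →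
                       x ℚ.≤ c ℚ.* (x ℚ.* r)
≤-scale-*-reciprocal {x} {s} {c} {r} 0≤x s≤c 0≤r sr≡1 = begin
  x                  ≡⟨ sym (*-identityʳ x) ⟩
  x ℚ.* 1ℚ           ≡⟨ cong (x ℚ.*_) (sym sr≡1) ⟩
  x ℚ.* (s ℚ.* r)    ≤⟨ *-monoˡ-≤-nonNeg x {{ℚ.nonNegative 0≤x}}
                          (*-monoʳ-≤-nonNeg r {{ℚ.nonNegative 0≤r}} s≤c) ⟩
  x ℚ.* (c ℚ.* r)    ≡⟨ sym (*-assoc x c r) ⟩
  x ℚ.* c ℚ.* r      ≡⟨ cong (ℚ._* r) (*-comm x c) ⟩
  c ℚ.* x ℚ.* r      ≡⟨ *-assoc c x r ⟩
  c ℚ.* (x ℚ.* r)    ∎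
  where open ≤-Reasoning

InQk⇒InPk : (k : ℕ) (G : Graph) (z : Arc G → ℚ) → ∃ (λ y → InQk G k y z) → InPk G k z
InQk⇒InPk k G z (y , circulation , y-sum , y≤z≤ky , y≥0) =
  circulation ,
  (λ e → 1≤+ (y-sum e) (y≤z (e , true)) (y≤z (e , false)) ,
         +≤-scale (y-sum e) (z≤ky (e , true)) (z≤ky (e , false))) ,
  λ a → ≤-trans (y≥0 a) (y≤z a)
  where
  y≤z : ∀ a → y a ℚ.≤ z a
  y≤z a = proj₁ (y≤z≤ky a)
  z≤ky : ∀ a → z a ℚ.≤ km1 k ℚ.* y a
  z≤ky a = proj₂ (y≤z≤ky a)

InPk⇒InQk : (k : ℕ) (G : Graph) (z : Arc G → ℚ) → InPk G k z → ∃ λ y → InQk G k y z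
InPk⇒InQk k G z (circulation , z-sum , z≥0) =
  y , circulation , y-sum , (λ a → y≤z a , z≤ky a) , y≥0
  where
  1≤s : ∀ e → 1ℚ ℚ.≤ z (e , true) ℚ.+ z (e , false)
  1≤s e = proj₁ (z-sum e)

  r : Fin (m G) → ℚ
  r e = proj₁ (reciprocal-of-1≤ (1≤s e))

  r≥0 : ∀ e → 0ℚ ℚ.≤ r e
  r≥0 e = proj₁ (proj₂ (reciprocal-of-1≤ (1≤s e)))

  sr≡1 : ∀ e → (z (e , true) ℚ.+ z (e , false)) ℚ.* r e ≡ 1ℚ
  sr≡1 e = proj₂ (proj₂ (reciprocal-of-1≤ (1≤s e)))

  y : Arc G → ℚ
  y (e , b) = z (e , b) ℚ.* r e

  y-sum : ∀ e → y (e , true) ℚ.+ y (e , false) ≡ 1ℚ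
  y-sum e = trans (sym (*-distribʳ-+ (r e) (z (e , true)) (z (e , false)))) (sr≡1 e)

  y≤z : ∀ a → y a ℚ.≤ z a
  y≤z (e , b) = *-reciprocal-≤ (z≥0 (e , b)) (1≤s e) (r≥0 e) (sr≡1 e)

  z≤ky : ∀ a → z a ℚ.≤ km1 k ℚ.* y a
  z≤ky (e , b) = ≤-scale-*-reciprocal (z≥0 (e , b)) (proj₂ (z-sum e)) (r≥0 e) (sr≡1 e)

  y≥0 : ∀ a → 0ℚ ℚ.≤ y a
  y≥0 (e , b) = nonNegative⁻¹ (y (e , b))
    {{nonNeg*nonNeg⇒nonNeg (z (e , b)) {{ℚ.nonNegative (z≥0 (e , b))}}
                           (r e) {{ℚ.nonNegative (r≥0 e)}}}}

lemma5p1 : (k : ℕ) → 2 ≤ k → (G : Graph) → (z : Arc G → ℚ) →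
    InPk G k z ⇔ ∃ (λ (y : Arc G → ℚ) → InQk G k y z)
lemma5p1 k _ G z = mk⇔ (InPk⇒InQk k G z) (InQk⇒InPk k G z)
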